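{- Let $Z$ be a non-degenerate multimatroid and let $\prec$ be a total ordering of its skew classes. Let $B$ and $B'$ be bases of $Z$ such that $\mathrm{act}_{\prec}(B)=\mathrm{act}_{\prec}(B')$ and $B_{\omega}=B'_{\omega}$ for all $\omega$ in $\mathrm{inact}_{\prec}(B)$. Then $\underline B_{\omega}=\underline B'_{\omega}$ for each $\omega\in \mathrm{act}_{\prec}(B)$.
   Context: A carrier is a pair $(U,\Omega)$, $U$ finite, $\Omega$ a partition of $U$ into non-empty skew classes; subtransversals meet each skew class at most once, transversals exactly once; skew pair: two distinct elements of a skew class. A multimatroid $Z=(U,\Omega,r)$ has a non-negative integer $r$ on subtransversals with (R1) on each transversal $r$ is a matroid rank function; (R2) for subtransversal $S$ and skew pair $\{x,y\}$ in a skew class disjoint from $S$, $r(S\cup\{x\})+r(S\cup\{y\})-2r(S)\ge1$. Bases: maximal subtransversals $S$ with $r(S)=|S|$; circuits: minimal subtransversals with $r(S)<|S|$. Non-degenerate: all skew classes have size $\ge2$ (bases are transversals). $B_\omega$ is the element of $B\cap\omega$. For basis $B$ and skew class $\omega$, $B\cup\omega$ contains at most one circuit $C(B,\omega)$; $\underline B_\omega$ is the element of $C(B,\omega)-B$. $\prec$ induces an order on any subtransversal with least element $\min$. $\omega$ is active w.r.t. $B$ if $C(B,\omega)$ exists and $\min C(B,\omega)\in\omega$, inactive otherwise; $\mathrm{act}_\prec(B)$, $\mathrm{inact}_\prec(B)$ denote these sets. -}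

module Defs where

open import Data.Nat using (ℕ; _+_; _*_; _≤_; _<_)
open import Data.Fin using (Fin)
open import Data.Fin.Subset using (Subset; _∈_; _∉_; _⊆_; _∪_; _∩_; ∣_∣; ⁅_⁆)
open import Data.Vec using (tabulate)
open import Data.Bool using (if_then_else_)
open import Data.Fin.Subset using (inside; outside)
open import Data.Fin.Properties using (_≟_)
open import Relation.Nullary using (¬_; does)
open import Relation.Binary using (IsStrictTotalOrder; Rel)
open import Relation.Binary.PropositionalEquality using (_≡_)
open import Data.Product using (Σ; ∃; _×_; ∃-syntax)
open import Data.Sum using (_⊎_)
open import Function.Bundles using (_⇔_)
open import Level using (0ℓ)

-- A carrier: ground set U = Fin n, skew classes indexed by Fin k,
-- cls x = the skew class of x.  Every class is non-empty (cls surjective).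
record Carrier : Set where
  field
    n    : ℕ
    k    : ℕ
    cls  : Fin n → Fin k
    nonempty : ∀ (ω : Fin k) → ∃[ x ] (cls x ≡ ω)

module _ (Ω : Carrier) where
  open Carrier Ω

  classSet : Fin k → Subset n
  classSet ω = tabulate (λ x → if does (cls x ≟ ω) then inside else outside)

  Subtransversal : Subset n → Set
  Subtransversal S = ∀ x y → x ∈ S → y ∈ S → cls x ≡ cls y → x ≡ y

  Transversal : Subset n → Set
  Transversal T = Subtransversal T × (∀ ω → ∃[ x ] (x ∈ T × cls x ≡ ω))

  IsMatroidRankOn : (Subset n → ℕ) → Subset n → Set
  IsMatroidRankOn r T =
    (∀ X → X ⊆ T → r X ≤ ∣ X ∣) ×
    (∀ X Y → X ⊆ T → Y ⊆ T → X ⊆ Y → r X ≤ r Y) ×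
    (∀ X Y → X ⊆ T → Y ⊆ T → r (X ∪ Y) + r (X ∩ Y) ≤ r X + r Y)

-- A multimatroid; r is only meaningful on subtransversals.
record Multimatroid : Set where
  field
    carrier : Carrier
  open Carrier carrier public
  field
    r  : Subset n → ℕ
    R1 : ∀ T → Transversal carrier T → IsMatroidRankOn carrier r T
    R2 : ∀ S x y → Subtransversal carrier S → ¬ (x ≡ y) → cls x ≡ cls y →
         (∀ z → z ∈ S → ¬ (cls z ≡ cls x)) →
         1 + 2 * r S ≤ r (S ∪ ⁅ x ⁆) + r (S ∪ ⁅ y ⁆)

module _ (Z : Multimatroid) where
  open Multimatroid Z

  NonDegenerate : Set
  NonDegenerate = ∀ ω → ∃[ x ] ∃[ y ] (¬ (x ≡ y) × cls x ≡ ω × cls y ≡ ω)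

  Independent : Subset n → Set
  Independent S = Subtransversal carrier S × r S ≡ ∣ S ∣

  IsBasis : Subset n → Set
  IsBasis B = Independent B × (∀ S → Independent S → B ⊆ S → S ⊆ B)

  IsCircuit : Subset n → Set
  IsCircuit C = Subtransversal carrier C × r C < ∣ C ∣ ×
                (∀ D → D ⊆ C → r D < ∣ D ∣ → D ≡ C)

  IsFundCircuit : Subset n → Fin k → Subset n → Set
  IsFundCircuit B ω C = IsCircuit C × C ⊆ (B ∪ classSet carrier ω)

  module _ (_≺_ : Rel (Fin k) 0ℓ) where
    IsMin : Subset n → Fin n → Set
    IsMin S x = x ∈ S × (∀ y → y ∈ S → cls x ≡ cls y ⊎ cls x ≺ cls y)

    Active : Subset n → Fin k → Set
    Active B ω = ∃[ C ] (IsFundCircuit B ω C × ∃[ x ] (IsMin C x × cls x ≡ ω))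

    Inactive : Subset n → Fin k → Set
    Inactive B ω = ¬ Active B ω

-- A subtransversal S spans at most one element of a skew class it avoids: for two such elements
-- x ≠ y we would have r(S ∪ x) = r(S) = r(S ∪ y), against (R2).  Applied to B − ω, this says that
-- all fundamental circuits of B at ω share their ω-element.
-- Now let ω be active, so that C = C(B,ω) has its ≺-least element x₀ in ω.  Every other class ν
-- of C satisfies ω ≺ ν and is inactive: if C(B,ν) had its minimum in ν it would avoid ω, so C and
-- C(B,ν) would both be fundamental circuits at ν of B₀ = (B − ω) ∪ {x₀}, forcing B_ν = B̲_ν ∉ B.
-- Hence B' agrees with B on every class of C but ω, C is also the fundamental circuit of B' at ω,
-- and B̲_ω = x₀ = B̲'_ω.
module Submission where

open import Defs
open import Data.Fin using (Fin)
open import Data.Fin.Subset using (Subset; _∈_; _∉_)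
open import Relation.Binary using (IsStrictTotalOrder; Rel)
open import Relation.Binary.PropositionalEquality using (_≡_)
open import Function.Bundles using (_⇔_)
open import Level using (0ℓ)

open import Data.Bool using (true; false; if_then_else_)
open import Data.Fin.Properties using (_≟_; any?)
open import Data.Fin.Subset using (_⊆_; _∪_; _∩_; _─_; _-_; ∣_∣; ⁅_⁆; inside; outside; Nonempty)
open import Data.Fin.Subset.Properties
  using (_∈?_; nonempty?; Empty-unique; ∣⊥∣≡0; x∈⁅x⁆; x∈⁅y⁆⇒x≡y; ∣⁅x⁆∣≡1; p⊆q⇒∣p∣≤∣q∣;
         p⊆p∪q; q⊆p∪q; x∈p∪q⁻; x∈p∩q⁺; x∈p∩q⁻; p∩q⊆q; p─q⊆p; x∈p∧x∉q⇒x∈p─q; x∈p∧x≢y⇒x∈p-y;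
         x∈p⇒∣p-x∣<∣p∣)
open import Data.Nat using (suc; _+_; _≤_; _<_; z≤n; s≤s)
open import Data.Nat.Properties
  using (≤-trans; ≤-reflexive; ≤-pred; ≮⇒≥; ≤∧≢⇒<; 1+n≰n; n≮0; <-irrefl;
         n≤1+n; +-suc; +-comm; +-identityʳ; +-mono-≤; +-monoˡ-≤; +-monoʳ-≤; +-cancelʳ-≤;
         module ≤-Reasoning)
open import Data.Product using (∃-syntax; _×_; _,_; proj₁; proj₂)
open import Data.Sum using (_⊎_; inj₁; inj₂; [_,_]′; map₂)
open import Data.Vec using (tabulate; _∷_; []; here; there)
open import Data.Vec.Properties using (lookup∘tabulate; []=⇒lookup; lookup⇒[]=)
open import Function.Base using (_∘_; id)
open import Relation.Binary using (Asymmetric)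
open import Relation.Binary.PropositionalEquality using (refl; sym; trans; cong; subst; subst₂; _≢_)
open import Relation.Nullary using (¬_; Dec; yes; no; does; contradiction)
open import Relation.Nullary.Decidable using (_×-dec_; _⊎-dec_; ¬?; dec-true)
open import Relation.Unary using (Pred; Decidable)

select : ∀ {n} {P : Pred (Fin n) 0ℓ} → Decidable P → Subset n
select P? = tabulate (λ z → if does (P? z) then inside else outside)

∈-select⁺ : ∀ {n} {P : Pred (Fin n) 0ℓ} (P? : Decidable P) {x : Fin n} → P x → x ∈ select P?
∈-select⁺ P? {x} px = lookup⇒[]= x (select P?)
  (trans (lookup∘tabulate _ x) (cong (λ b → if b then inside else outside) (dec-true (P? x) px)))

∈-select⁻ : ∀ {n} {P : Pred (Fin n) 0ℓ} (P? : Decidable P) {x : Fin n} → x ∈ select P? → P x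
∈-select⁻ P? {x} x∈ with P? x | trans (sym (lookup∘tabulate _ x)) ([]=⇒lookup x∈)
... | yes px | _  = px
... | no _   | ()

∪-lub : ∀ {n} {p q r : Subset n} → p ⊆ r → q ⊆ r → p ∪ q ⊆ r
∪-lub {p = p} {q} p⊆r q⊆r x∈ = [ p⊆r , q⊆r ]′ (x∈p∪q⁻ p q x∈)

⁅x⁆⊆p : ∀ {n} {x : Fin n} {p : Subset n} → x ∈ p → ⁅ x ⁆ ⊆ p
⁅x⁆⊆p {x = x} {p} x∈p y∈ = subst (_∈ p) (sym (x∈⁅y⁆⇒x≡y x y∈)) x∈p

x∈p─q⇒x∉q : ∀ {n} (p q : Subset n) {x : Fin n} → x ∈ p ─ q → x ∉ q
x∈p─q⇒x∉q (true ∷ p) (false ∷ q) here        ()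
x∈p─q⇒x∉q (_    ∷ p) (_     ∷ q) (there x∈) (there x∈q) = x∈p─q⇒x∉q p q x∈ x∈q

∣p∪q∣≤∣p∣+∣q∣ : ∀ {n} (p q : Subset n) → ∣ p ∪ q ∣ ≤ ∣ p ∣ + ∣ q ∣
∣p∪q∣≤∣p∣+∣q∣ []          []          = z≤n
∣p∪q∣≤∣p∣+∣q∣ (true  ∷ p) (true  ∷ q) = s≤s (≤-trans (∣p∪q∣≤∣p∣+∣q∣ p q) (+-monoʳ-≤ ∣ p ∣ (n≤1+n ∣ q ∣)))
∣p∪q∣≤∣p∣+∣q∣ (true  ∷ p) (false ∷ q) = s≤s (∣p∪q∣≤∣p∣+∣q∣ p q)
∣p∪q∣≤∣p∣+∣q∣ (false ∷ p) (true  ∷ q) =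
  ≤-trans (s≤s (∣p∪q∣≤∣p∣+∣q∣ p q)) (≤-reflexive (sym (+-suc ∣ p ∣ ∣ q ∣)))
∣p∪q∣≤∣p∣+∣q∣ (false ∷ p) (false ∷ q) = ∣p∪q∣≤∣p∣+∣q∣ p q

∣p∪⁅x⁆∣≤1+∣p∣ : ∀ {n} (p : Subset n) (x : Fin n) → ∣ p ∪ ⁅ x ⁆ ∣ ≤ suc ∣ p ∣
∣p∪⁅x⁆∣≤1+∣p∣ p x = ≤-trans (∣p∪q∣≤∣p∣+∣q∣ p ⁅ x ⁆)
  (≤-reflexive (trans (cong (∣ p ∣ +_) (∣⁅x⁆∣≡1 x)) (+-comm ∣ p ∣ 1)))

module _ (Z : Multimatroid) where
  open Multimatroid Z

  private variable
    S T X Y B B' C C' : Subset n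
    x y z : Fin n
    ω ν : Fin k

  Avoids : Subset n → Fin k → Set
  Avoids S ω = ∀ z → z ∈ S → cls z ≢ ω

  Meets : Subset n → Fin k → Set
  Meets S ω = ∃[ x ] (x ∈ S × cls x ≡ ω)

  meets? : ∀ S ω → Dec (Meets S ω)
  meets? S ω = any? (λ x → (x ∈? S) ×-dec (cls x ≟ ω))

  ∈classSet⁺ : cls x ≡ ω → x ∈ classSet carrier ω
  ∈classSet⁺ {ω = ω} = ∈-select⁺ (λ x → cls x ≟ ω)

  ∈classSet⁻ : x ∈ classSet carrier ω → cls x ≡ ω
  ∈classSet⁻ {ω = ω} = ∈-select⁻ (λ x → cls x ≟ ω)

  infixl 7 _∖_
  _∖_ : Subset n → Fin k → Subset n
  S ∖ ω = S ─ classSet carrier ω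

  ∈∖⁺ : x ∈ S → cls x ≢ ω → x ∈ S ∖ ω
  ∈∖⁺ x∈S cx≢ω = x∈p∧x∉q⇒x∈p─q x∈S (λ x∈ω → cx≢ω (∈classSet⁻ x∈ω))

  ∖-⊆ : S ∖ ω ⊆ S
  ∖-⊆ {S} {ω} = p─q⊆p S (classSet carrier ω)

  ∖-avoids : Avoids (S ∖ ω) ω
  ∖-avoids {S} {ω} z z∈ cz≡ω = x∈p─q⇒x∉q S (classSet carrier ω) z∈ (∈classSet⁺ cz≡ω)

  ⊆-subtransversal : S ⊆ T → Subtransversal carrier T → Subtransversal carrier S
  ⊆-subtransversal S⊆T stT x y x∈ y∈ = stT x y (S⊆T x∈) (S⊆T y∈)

  ∪⁅⁆-subtransversal : Subtransversal carrier S → Avoids S (cls x) → Subtransversal carrier (S ∪ ⁅ x ⁆)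
  ∪⁅⁆-subtransversal {S} {x} stS avoid y z y∈ z∈ cy≡cz with x∈p∪q⁻ S ⁅ x ⁆ y∈ | x∈p∪q⁻ S ⁅ x ⁆ z∈
  ... | inj₁ y∈S | inj₁ z∈S = stS y z y∈S z∈S cy≡cz
  ... | inj₁ y∈S | inj₂ z∈x = contradiction (trans cy≡cz (cong cls (x∈⁅y⁆⇒x≡y x z∈x))) (avoid y y∈S)
  ... | inj₂ y∈x | inj₁ z∈S = contradiction (trans (sym cy≡cz) (cong cls (x∈⁅y⁆⇒x≡y x y∈x))) (avoid z z∈S)
  ... | inj₂ y∈x | inj₂ z∈x = trans (x∈⁅y⁆⇒x≡y x y∈x) (sym (x∈⁅y⁆⇒x≡y x z∈x))

  extend-to-transversal : Subtransversal carrier S → ∃[ T ] (Transversal carrier T × S ⊆ T)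
  extend-to-transversal {S} stS = S⁺ , (stS⁺ , meetsS⁺) , ∈-select⁺ P? ∘ inj₁
    where
    rep : Fin k → Fin n
    rep ω = proj₁ (nonempty ω)

    P? : Decidable (λ z → z ∈ S ⊎ (¬ Meets S (cls z) × z ≡ rep (cls z)))
    P? z = (z ∈? S) ⊎-dec (¬? (meets? S (cls z)) ×-dec (z ≟ rep (cls z)))

    S⁺ : Subset n
    S⁺ = select P?

    stS⁺ : Subtransversal carrier S⁺
    stS⁺ y z y∈ z∈ cy≡cz with ∈-select⁻ P? y∈ | ∈-select⁻ P? z∈
    ... | inj₁ y∈S          | inj₁ z∈S          = stS y z y∈S z∈S cy≡cz
    ... | inj₁ y∈S          | inj₂ (misses , _) = contradiction (y , y∈S , cy≡cz) misses
    ... | inj₂ (misses , _) | inj₁ z∈S          = contradiction (z , z∈S , sym cy≡cz) misses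
    ... | inj₂ (_ , y≡rep)  | inj₂ (_ , z≡rep)  = trans y≡rep (trans (cong rep cy≡cz) (sym z≡rep))

    meetsS⁺ : ∀ ω → Meets S⁺ ω
    meetsS⁺ ω with meets? S ω
    ... | yes (y , y∈S , cy≡ω) = y , ∈-select⁺ P? (inj₁ y∈S) , cy≡ω
    ... | no misses            = rep ω , ∈-select⁺ P? (inj₂ (misses′ , cong rep (sym cls-rep))) , cls-rep
      where
      cls-rep : cls (rep ω) ≡ ω
      cls-rep = proj₂ (nonempty ω)
      misses′ : ¬ Meets S (cls (rep ω))
      misses′ = subst (λ ν → ¬ Meets S ν) (sym cls-rep) misses

  r≤∣∣ : Subtransversal carrier X → r X ≤ ∣ X ∣
  r≤∣∣ {X} stX with T , trT , X⊆T ← extend-to-transversal stX = proj₁ (R1 T trT) X X⊆T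

  r-mono : Subtransversal carrier Y → X ⊆ Y → r X ≤ r Y
  r-mono {Y} {X} stY X⊆Y with T , trT , Y⊆T ← extend-to-transversal stY =
    proj₁ (proj₂ (R1 T trT)) X Y (Y⊆T ∘ X⊆Y) Y⊆T X⊆Y

  r-submodular : Subtransversal carrier (X ∪ Y) → r (X ∪ Y) + r (X ∩ Y) ≤ r X + r Y
  r-submodular {X} {Y} stX∪Y with T , trT , X∪Y⊆T ← extend-to-transversal stX∪Y =
    proj₂ (proj₂ (R1 T trT)) X Y (X∪Y⊆T ∘ p⊆p∪q Y) (X∪Y⊆T ∘ q⊆p∪q X Y)

  -- Axiom (R2) in contrapositive form.
  absorbed-unique : Subtransversal carrier S → Avoids S (cls x) → cls x ≡ cls y →
                    r (S ∪ ⁅ x ⁆) ≤ r S → r (S ∪ ⁅ y ⁆) ≤ r S → x ≡ y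
  absorbed-unique {S} {x} {y} stS avoid cx≡cy x-absorbed y-absorbed with x ≟ y
  ... | yes x≡y = x≡y
  ... | no x≢y  = contradiction
    (subst (λ m → suc m ≤ r S + r S) (cong (r S +_) (+-identityʳ (r S)))
      (≤-trans (R2 S x y stS x≢y cx≡cy avoid) (+-mono-≤ x-absorbed y-absorbed)))
    1+n≰n

  Spans : Subset n → Fin n → Set
  Spans S x = ∃[ C ] (IsCircuit Z C × x ∈ C × C ⊆ S ∪ ⁅ x ⁆)

  spans⇒absorbed : Subtransversal carrier (S ∪ ⁅ x ⁆) → x ∉ S → Spans S x → r (S ∪ ⁅ x ⁆) ≤ r S
  spans⇒absorbed {S} {x} stS∪x x∉S (C , (_ , r<∣C∣ , minimal) , x∈C , C⊆S∪x) =
    +-cancelʳ-≤ (r D) (r (S ∪ ⁅ x ⁆)) (r S) (begin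
      r (S ∪ ⁅ x ⁆) + r D  ≤⟨ +-monoˡ-≤ (r D) (r-mono stS∪C S∪x⊆S∪C) ⟩
      r (S ∪ C) + r D      ≤⟨ r-submodular stS∪C ⟩
      r S + r C            ≤⟨ +-monoʳ-≤ (r S) rC≤rD ⟩
      r S + r D            ∎)
    where
    open ≤-Reasoning

    D : Subset n
    D = S ∩ C

    S∪C⊆S∪x : S ∪ C ⊆ S ∪ ⁅ x ⁆
    S∪C⊆S∪x = ∪-lub (p⊆p∪q ⁅ x ⁆) C⊆S∪x

    S∪x⊆S∪C : S ∪ ⁅ x ⁆ ⊆ S ∪ C
    S∪x⊆S∪C = ∪-lub (p⊆p∪q C) (q⊆p∪q S C ∘ ⁅x⁆⊆p x∈C)

    stS∪C : Subtransversal carrier (S ∪ C)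
    stS∪C = ⊆-subtransversal S∪C⊆S∪x stS∪x

    C⊆D∪x : C ⊆ D ∪ ⁅ x ⁆
    C⊆D∪x z∈C = [ (λ z∈S → p⊆p∪q ⁅ x ⁆ (x∈p∩q⁺ (z∈S , z∈C))) , q⊆p∪q D ⁅ x ⁆ ]′
                  (x∈p∪q⁻ S ⁅ x ⁆ (C⊆S∪x z∈C))

    -- D is a proper subset of the circuit C, as x ∉ S.
    D-independent : ∣ D ∣ ≤ r D
    D-independent = ≮⇒≥ (λ rD<∣D∣ →
      x∉S (proj₁ (x∈p∩q⁻ S C (subst (x ∈_) (sym (minimal D (p∩q⊆q S C) rD<∣D∣)) x∈C))))

    rC≤rD : r C ≤ r D
    rC≤rD = ≤-pred (begin-strict
      r C            <⟨ r<∣C∣ ⟩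
      ∣ C ∣          ≤⟨ p⊆q⇒∣p∣≤∣q∣ C⊆D∪x ⟩
      ∣ D ∪ ⁅ x ⁆ ∣  ≤⟨ ∣p∪⁅x⁆∣≤1+∣p∣ D x ⟩
      suc ∣ D ∣      ≤⟨ s≤s D-independent ⟩
      suc (r D)      ∎)

  spans-unique : Subtransversal carrier S → Avoids S ω → cls x ≡ ω → cls y ≡ ω →
                 Spans S x → Spans S y → x ≡ y
  spans-unique {S} {ω} {x} {y} stS avoid cx≡ω cy≡ω S-spans-x S-spans-y =
    absorbed-unique stS avoidₓ (trans cx≡ω (sym cy≡ω))
      (spans⇒absorbed (∪⁅⁆-subtransversal stS avoidₓ) (λ x∈S → avoid x x∈S cx≡ω) S-spans-x)
      (spans⇒absorbed (∪⁅⁆-subtransversal stS avoidʸ) (λ y∈S → avoid y y∈S cy≡ω) S-spans-y)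
    where
    avoidₓ : Avoids S (cls x)
    avoidₓ = subst (Avoids S) (sym cx≡ω) avoid
    avoidʸ : Avoids S (cls y)
    avoidʸ = subst (Avoids S) (sym cy≡ω) avoid

  circuit-nonempty : IsCircuit Z C → Nonempty C
  circuit-nonempty {C} (_ , r<∣C∣ , _) with nonempty? C
  ... | yes C≢∅ = C≢∅
  ... | no  C≡∅ = contradiction (subst (r C <_) (trans (cong ∣_∣ (Empty-unique C≡∅)) (∣⊥∣≡0 n)) r<∣C∣) n≮0

  circuit⊆⇒r<∣∣ : Subtransversal carrier X → IsCircuit Z C → y ∈ C → C ⊆ X → r X < ∣ X ∣
  circuit⊆⇒r<∣∣ {X} {C} {y} stX circuit y∈C C⊆X = begin-strict
    r X                  ≤⟨ r-mono stX-y∪y X⊆X-y∪y ⟩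
    r ((X - y) ∪ ⁅ y ⁆)  ≤⟨ spans⇒absorbed stX-y∪y y∉X-y (C , circuit , y∈C , X⊆X-y∪y ∘ C⊆X) ⟩
    r (X - y)            ≤⟨ r≤∣∣ (⊆-subtransversal (p─q⊆p X ⁅ y ⁆) stX) ⟩
    ∣ X - y ∣            <⟨ x∈p⇒∣p-x∣<∣p∣ (C⊆X y∈C) ⟩
    ∣ X ∣                ∎
    where
    open ≤-Reasoning

    y∉X-y : y ∉ X - y
    y∉X-y y∈X-y = x∈p─q⇒x∉q X ⁅ y ⁆ y∈X-y (x∈⁅x⁆ y)

    X⊆X-y∪y : X ⊆ (X - y) ∪ ⁅ y ⁆
    X⊆X-y∪y {z} z∈X with z ≟ y
    ... | yes refl = q⊆p∪q (X - y) ⁅ y ⁆ (x∈⁅x⁆ y)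
    ... | no z≢y   = p⊆p∪q ⁅ y ⁆ (x∈p∧x≢y⇒x∈p-y z∈X z≢y)

    stX-y∪y : Subtransversal carrier ((X - y) ∪ ⁅ y ⁆)
    stX-y∪y = ⊆-subtransversal (∪-lub (p─q⊆p X ⁅ y ⁆) (⁅x⁆⊆p (C⊆X y∈C))) stX

  independent⇒circuit⊈ : Independent Z X → IsCircuit Z C → ¬ (C ⊆ X)
  independent⇒circuit⊈ (stX , rX≡∣X∣) circuit C⊆X with y , y∈C ← circuit-nonempty circuit =
    <-irrefl rX≡∣X∣ (circuit⊆⇒r<∣∣ stX circuit y∈C C⊆X)

  basis-absorbs : IsBasis Z B → Avoids B (cls x) → r (B ∪ ⁅ x ⁆) ≤ r B
  basis-absorbs {B} {x} ((stB , rB≡∣B∣) , maximal) avoid =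
    subst (r (B ∪ ⁅ x ⁆) ≤_) (sym rB≡∣B∣)
      (≤-pred (≤-trans (≤∧≢⇒< (r≤∣∣ stB∪x) dependent) (∣p∪⁅x⁆∣≤1+∣p∣ B x)))
    where
    stB∪x : Subtransversal carrier (B ∪ ⁅ x ⁆)
    stB∪x = ∪⁅⁆-subtransversal stB avoid

    dependent : r (B ∪ ⁅ x ⁆) ≢ ∣ B ∪ ⁅ x ⁆ ∣
    dependent independent =
      avoid x (maximal (B ∪ ⁅ x ⁆) (stB∪x , independent) (p⊆p∪q ⁅ x ⁆) (q⊆p∪q B ⁅ x ⁆ (x∈⁅x⁆ x))) refl

  basis-meets : NonDegenerate Z → IsBasis Z B → ∀ ω → Meets B ω
  basis-meets {B} nd basis ω with meets? B ω | nd ω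
  ... | yes meets | _                             = meets
  ... | no misses | x , y , x≢y , cx≡ω , cy≡ω =
    contradiction (absorbed-unique (proj₁ (proj₁ basis)) avoidₓ (trans cx≡ω (sym cy≡ω))
                     (basis-absorbs basis avoidₓ) (basis-absorbs basis avoidʸ)) x≢y
    where
    avoid : Avoids B ω
    avoid z z∈B cz≡ω = misses (z , z∈B , cz≡ω)
    avoidₓ : Avoids B (cls x)
    avoidₓ = subst (Avoids B) (sym cx≡ω) avoid
    avoidʸ : Avoids B (cls y)
    avoidʸ = subst (Avoids B) (sym cy≡ω) avoid

  fundamental-⊆ : IsFundCircuit Z B ω C → z ∈ C → z ∈ B ⊎ cls z ≡ ω
  fundamental-⊆ {B} (_ , C⊆B∪ω) z∈C = map₂ ∈classSet⁻ (x∈p∪q⁻ B _ (C⊆B∪ω z∈C))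

  fundamental-∉⇒class : IsFundCircuit Z B ω C → x ∈ C → x ∉ B → cls x ≡ ω
  fundamental-∉⇒class fund x∈C x∉B = [ (λ x∈B → contradiction x∈B x∉B) , id ]′ (fundamental-⊆ fund x∈C)

  fundamental-split : IsFundCircuit Z B ω C → y ∈ C → cls y ≡ ω → z ∈ C → z ≡ y ⊎ (z ∈ B × cls z ≢ ω)
  fundamental-split {ω = ω} {y = y} {z = z} fund y∈C cy≡ω z∈C with cls z ≟ ω
  ... | yes cz≡ω = inj₁ (proj₁ (proj₁ fund) z y z∈C y∈C (trans cz≡ω (sym cy≡ω)))
  ... | no  cz≢ω = inj₂ ([ id , (λ cz≡ω → contradiction cz≡ω cz≢ω) ]′ (fundamental-⊆ fund z∈C) , cz≢ω)

  fundamental-⊆∖∪ : IsFundCircuit Z B ω C → y ∈ C → cls y ≡ ω → C ⊆ (B ∖ ω) ∪ ⁅ y ⁆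
  fundamental-⊆∖∪ {B} {ω} {y = y} fund y∈C cy≡ω z∈C with fundamental-split fund y∈C cy≡ω z∈C
  ... | inj₁ refl         = q⊆p∪q (B ∖ ω) ⁅ y ⁆ (x∈⁅x⁆ y)
  ... | inj₂ (z∈B , cz≢ω) = p⊆p∪q ⁅ y ⁆ (∈∖⁺ z∈B cz≢ω)

  fundamental-mono : B ⊆ B' → IsFundCircuit Z B ω C → IsFundCircuit Z B' ω C
  fundamental-mono {B} {B'} {ω} B⊆B' (circuit , C⊆B∪ω) =
    circuit , ∪-lub (p⊆p∪q _ ∘ B⊆B') (q⊆p∪q B' _) ∘ C⊆B∪ω

  fundamental-∖ : IsFundCircuit Z B ω C → Avoids C ν → IsFundCircuit Z (B ∖ ν) ω C
  fundamental-∖ {B} {ω} {C} {ν} (circuit , C⊆B∪ω) avoid = circuit , C⊆B∖ν∪ω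
    where
    C⊆B∖ν∪ω : C ⊆ (B ∖ ν) ∪ classSet carrier ω
    C⊆B∖ν∪ω {z} z∈C with x∈p∪q⁻ B _ (C⊆B∪ω z∈C)
    ... | inj₁ z∈B = p⊆p∪q _ (∈∖⁺ z∈B (avoid z z∈C))
    ... | inj₂ z∈ω = q⊆p∪q (B ∖ ν) _ z∈ω

  fundamental-class-element-unique : Subtransversal carrier B →
    IsFundCircuit Z B ω C → IsFundCircuit Z B ω C' → x ∈ C → cls x ≡ ω → y ∈ C' → cls y ≡ ω → x ≡ y
  fundamental-class-element-unique stB fund fund′ x∈C cx≡ω y∈C′ cy≡ω =
    spans-unique (⊆-subtransversal ∖-⊆ stB) ∖-avoids cx≡ω cy≡ω
      (_ , proj₁ fund , x∈C , fundamental-⊆∖∪ fund x∈C cx≡ω)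
      (_ , proj₁ fund′ , y∈C′ , fundamental-⊆∖∪ fund′ y∈C′ cy≡ω)

  module _ {_≺_ : Rel (Fin k) 0ℓ} (≺-asym : Asymmetric _≺_) where

    min-≺ : IsMin Z _≺_ C x → y ∈ C → cls y ≢ cls x → cls x ≺ cls y
    min-≺ (_ , x-min) y∈C cy≢cx = [ (λ cx≡cy → contradiction (sym cx≡cy) cy≢cx) , id ]′ (x-min _ y∈C)

    ≺-min⇒avoids : IsMin Z _≺_ C x → ω ≺ cls x → Avoids C ω
    ≺-min⇒avoids (_ , x-min) ω≺cx z z∈C refl with x-min z z∈C
    ... | inj₁ cx≡cz = let ω≺ω = subst (cls z ≺_) cx≡cz ω≺cx in ≺-asym ω≺ω ω≺ω
    ... | inj₂ cx≺cz = ≺-asym ω≺cx cx≺cz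

    fundamental-classes-inactive : Independent Z B → IsFundCircuit Z B ω C → IsMin Z _≺_ C x → cls x ≡ ω →
      y ∈ C → cls y ≢ ω → Inactive Z _≺_ B (cls y)
    fundamental-classes-inactive {B} {ω} {C} {x} {y} indep fund x-min cx≡ω y∈C cy≢ω
      (C₁ , fund₁ , x₁ , x₁-min , cx₁≡cy) = x₁∉B (subst (_∈ B) y≡x₁ y∈B)
      where
      y∈B : y ∈ B
      y∈B = [ (λ y≡x → contradiction (trans (cong cls y≡x) cx≡ω) cy≢ω) , proj₁ ]′
              (fundamental-split fund (proj₁ x-min) cx≡ω y∈C)

      x₁∉B : x₁ ∉ B
      x₁∉B x₁∈B = independent⇒circuit⊈ indep (proj₁ fund₁)
        (∪-lub ∖-⊆ (⁅x⁆⊆p x₁∈B) ∘ fundamental-⊆∖∪ fund₁ (proj₁ x₁-min) cx₁≡cy)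

      C₁-avoids-ω : Avoids C₁ ω
      C₁-avoids-ω = ≺-min⇒avoids x₁-min
        (subst₂ _≺_ cx≡ω (sym cx₁≡cy) (min-≺ x-min y∈C (λ cy≡cx → cy≢ω (trans cy≡cx cx≡ω))))

      -- B with its ω-element replaced by x; both C and C₁ are fundamental circuits of it at cls y.
      B₀ : Subset n
      B₀ = (B ∖ ω) ∪ ⁅ x ⁆

      stB₀ : Subtransversal carrier B₀
      stB₀ = ∪⁅⁆-subtransversal (⊆-subtransversal ∖-⊆ (proj₁ indep))
               (subst (Avoids (B ∖ ω)) (sym cx≡ω) ∖-avoids)

      y≡x₁ : y ≡ x₁
      y≡x₁ = fundamental-class-element-unique stB₀
        (proj₁ fund , p⊆p∪q _ ∘ fundamental-⊆∖∪ fund (proj₁ x-min) cx≡ω)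
        (fundamental-mono (p⊆p∪q ⁅ x ⁆) (fundamental-∖ fund₁ C₁-avoids-ω))
        y∈C refl (proj₁ x₁-min) cx₁≡cy

    fundamental-transfer : NonDegenerate Z → Independent Z B → IsBasis Z B' →
      (∀ ν → Inactive Z _≺_ B ν → ∀ y y' → y ∈ B → cls y ≡ ν → y' ∈ B' → cls y' ≡ ν → y ≡ y') →
      IsFundCircuit Z B ω C → IsMin Z _≺_ C x → cls x ≡ ω → IsFundCircuit Z B' ω C
    fundamental-transfer {B} {B'} {ω} {C} nd indep basis′ agree fund x-min cx≡ω = proj₁ fund , C⊆B'∪ω
      where
      C⊆B'∪ω : C ⊆ B' ∪ classSet carrier ω
      C⊆B'∪ω {z} z∈C with fundamental-split fund (proj₁ x-min) cx≡ω z∈C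
      ... | inj₁ refl = q⊆p∪q B' _ (∈classSet⁺ cx≡ω)
      ... | inj₂ (z∈B , cz≢ω) with z' , z'∈B' , cz'≡cz ← basis-meets nd basis′ (cls z) =
        p⊆p∪q _ (subst (_∈ B') (sym (agree (cls z) inactive z z' z∈B refl z'∈B' cz'≡cz)) z'∈B')
        where
        inactive : Inactive Z _≺_ B (cls z)
        inactive = fundamental-classes-inactive indep fund x-min cx≡ω z∈C cz≢ω

lemma3p17 : (Z : Multimatroid) → NonDegenerate Z →
    (_≺_ : Rel (Fin (Multimatroid.k Z)) 0ℓ) → IsStrictTotalOrder _≡_ _≺_ →
    (B B' : Subset (Multimatroid.n Z)) → IsBasis Z B → IsBasis Z B' →
    (∀ ω → Active Z _≺_ B ω ⇔ Active Z _≺_ B' ω) →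
    (∀ ω → Inactive Z _≺_ B ω → ∀ x y → x ∈ B → Multimatroid.cls Z x ≡ ω →
      y ∈ B' → Multimatroid.cls Z y ≡ ω → x ≡ y) →
    ∀ ω → Active Z _≺_ B ω →
    ∀ C C' x x' → IsFundCircuit Z B ω C → IsFundCircuit Z B' ω C' →
      x ∈ C → x ∉ B → x' ∈ C' → x' ∉ B' → x ≡ x'
lemma3p17 Z nd _≺_ ≺-sto B B' basis basis′ _ agree ω (C₀ , fund₀ , x₀ , x₀-min , cx₀≡ω)
          C C' x x' fund fund′ x∈C x∉B x'∈C' x'∉B' =
  trans (fundamental-class-element-unique Z (proj₁ (proj₁ basis))
           fund fund₀ x∈C (fundamental-∉⇒class Z fund x∈C x∉B) (proj₁ x₀-min) cx₀≡ω)
        (sym (fundamental-class-element-unique Z (proj₁ (proj₁ basis′))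
           fund′ fund₀′ x'∈C' (fundamental-∉⇒class Z fund′ x'∈C' x'∉B') (proj₁ x₀-min) cx₀≡ω))
  where
  fund₀′ : IsFundCircuit Z B' ω C₀
  fund₀′ = fundamental-transfer Z {_≺_} (IsStrictTotalOrder.asym ≺-sto)
             nd (proj₁ basis) basis′ agree fund₀ x₀-min cx₀≡ω
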